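{- For any two nonnegative integers $n \ge p$ and any complex number $\mu$, $$\sum_{k=0}^n S(n,k)\binom{k}{p}\mu^k \;=\; \mu^p\sum_{k=0}^n \binom{n}{k} S(k,p)\,\varphi_{n-k}(\mu).$$
   Context: $S(n,k)$ denotes the Stirling numbers of the second kind, defined by $\frac{1}{p!}(e^x-1)^p = \sum_{n\ge0} S(n,p)\frac{x^n}{n!}$ (so $S(0,0)=1$, $S(n,p)=0$ for $n<p$, $S(n,0)=0$ for $n\ge1$). The exponential polynomials are $\varphi_n(x) = \sum_{k=0}^n S(n,k)x^k$, with exponential generating function $e^{x(e^t-1)} = \sum_{n\ge0}\varphi_n(x)\frac{t^n}{n!}$. -}

module Defs where

open import Level using (Level)
open import Data.Nat using (ℕ; zero; suc)
import Data.Nat as N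
open import Algebra.Bundles using (CommutativeRing)
import Algebra.Definitions.RawSemiring as RS

-- Stirling numbers of the second kind S(n,k), via the standard recurrence
-- S(0,0)=1, S(0,k+1)=0, S(n+1,0)=0, S(n+1,k+1) = (k+1) S(n,k+1) + S(n,k),
-- which is equivalent to the e.g.f. (e^x-1)^p/p! = Σ S(n,p) x^n/n!.
S : ℕ → ℕ → ℕ
S zero    zero    = 1
S zero    (suc k) = 0
S (suc n) zero    = 0
S (suc n) (suc k) = suc k N.* S n (suc k) N.+ S n k

module _ {c ℓ : Level} (R : CommutativeRing c ℓ) where
  open CommutativeRing R
  open import Algebra.Bundles using (Semiring)
  open RS (Semiring.rawSemiring semiring) using (_×_; _^_)

  ι : ℕ → Carrier
  ι m = m × 1#

  pow : Carrier → ℕ → Carrier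
  pow x k = x ^ k

  sumTo : ℕ → (ℕ → Carrier) → Carrier
  sumTo zero    f = f 0
  sumTo (suc n) f = sumTo n f + f (suc n)

  φ : ℕ → Carrier → Carrier
  φ n x = sumTo n (λ k → ι (S n k) * pow x k)

{-# OPTIONS --safe #-}
-- Expanding φ_{n-k}(μ) and exchanging the two sums turns the right-hand side into
-- μ^p Σ_j (Σ_k C(n,k) S(k,p) S(n-k,j)) μ^j. The inner sum counts the partitions of an
-- n-set into p red and j blue blocks (k being the number of elements in red blocks),
-- so it equals C(p+j,p) S(n,p+j); the substitution k = p + j turns the left-hand side
-- into the same series. The convolution identity is proved by induction on n: both
-- sides obey the same recurrence, by the product rule for binomial convolutions and
-- the recurrence of S.
module Submission where

open import Defs
open import Level using (Level)
open import Data.Nat using (ℕ; _≤_; _∸_; _*_)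
open import Data.Nat.Combinatorics using (_C_)
open import Algebra.Bundles using (CommutativeRing)

import Data.Nat as Nat
open import Data.Nat using (zero; suc; _<_; z≤n; s≤s)
open import Data.Nat.Combinatorics using (nCn≡1; k>n⇒nCk≡0; nCk+nC[k+1]≡[n+1]C[k+1])
open import Function using (_∘_)
open import Relation.Binary.PropositionalEquality as ≡ using (_≡_)

module StirlingArithmetic where
  open Nat using (_+_)
  open import Data.Nat.Properties using (*-zeroʳ; +-identityʳ; +-suc; m<n⇒m<1+n)
  open import Data.Nat.Solver using (module +-*-Solver)
  open +-*-Solver using (solve; _:+_; _:*_; _:=_)

  n<k⇒S[n,k]≡0 : ∀ {n k} → n < k → S n k ≡ 0
  n<k⇒S[n,k]≡0 {zero}  {suc k} _ = ≡.refl
  n<k⇒S[n,k]≡0 {suc n} {suc k} (s≤s n<k)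
    rewrite n<k⇒S[n,k]≡0 (m<n⇒m<1+n n<k) | n<k⇒S[n,k]≡0 n<k = ≡.cong (_+ 0) (*-zeroʳ (suc k))

  prev : (ℕ → ℕ) → ℕ → ℕ
  prev f zero    = 0
  prev f (suc k) = f k

  S-suc : ∀ n k → S (suc n) k ≡ k * S n k + prev (S n) k
  S-suc n zero    = ≡.refl
  S-suc n (suc k) = ≡.refl

  distrib-pascal : ∀ s X Y {a b c} → a + b ≡ c → (s * X + Y) * c ≡ s * (X * c) + Y * a + Y * b
  distrib-pascal s X Y {a} {b} ≡.refl =
    solve 5 (λ s X Y a b → (s :* X :+ Y) :* (a :+ b) := s :* (X :* (a :+ b)) :+ Y :* a :+ Y :* b)
          ≡.refl s X Y a b

  colouredS : ℕ → ℕ → ℕ → ℕ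
  colouredS n p j = S n (p + j) * ((p + j) C p)

  colouredS-suc : ∀ n p j → colouredS (suc n) p j ≡
    (p + j) * colouredS n p j + prev (λ q → colouredS n q j) p + prev (colouredS n p) j
  colouredS-suc n zero zero = ≡.refl
  colouredS-suc n zero (suc j) =
    ≡.trans (distrib-pascal (suc j) (S n (suc j)) (S n j) ≡.refl)
            (≡.cong (λ t → suc j * (S n (suc j) * 1) + t + S n j * 1) (*-zeroʳ (S n j)))
  colouredS-suc n (suc p) zero rewrite +-identityʳ p =
    ≡.trans (distrib-pascal (suc p) (S n (suc p)) (S n p) pascal-diagonal)
            (≡.cong (suc p * (S n (suc p) * (suc p C suc p)) + S n p * (p C p) +_) (*-zeroʳ (S n p)))
    where
    pascal-diagonal : p C p + 0 ≡ suc p C suc p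
    pascal-diagonal = ≡.trans (+-identityʳ (p C p)) (≡.trans (nCn≡1 p) (≡.sym (nCn≡1 (suc p))))
  colouredS-suc n (suc p) (suc j) rewrite +-suc p j =
    distrib-pascal (suc (suc (p + j))) (S n (suc (suc (p + j)))) (S n (suc (p + j)))
                   (nCk+nC[k+1]≡[n+1]C[k+1] (suc (p + j)) p)

module Embedding {c ℓ : Level} (R : CommutativeRing c ℓ) where
  open CommutativeRing R renaming (_*_ to _·_)
  import Algebra.Properties.Monoid.Mult +-monoid as Mult
  import Algebra.Properties.Semiring.Mult semiring as SemiringMult

  ι-cong : ∀ {a b} → a ≡ b → ι R a ≈ ι R b
  ι-cong a≡b = reflexive (≡.cong (ι R) a≡b)

  ι-+ : ∀ a b → ι R (a Nat.+ b) ≈ ι R a + ι R b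
  ι-+ = Mult.×-homo-+ 1#

  ι-* : ∀ a b → ι R (a * b) ≈ ι R a · ι R b
  ι-* = SemiringMult.×1-homo-*

  ι-1-·ˡ : ∀ x → ι R 1 · x ≈ x
  ι-1-·ˡ x = trans (*-congʳ (+-identityʳ 1#)) (*-identityˡ x)

  ι-0-·ˡ : ∀ {a} x → a ≡ 0 → ι R a · x ≈ 0#
  ι-0-·ˡ x ≡.refl = zeroˡ x

module Sums {c ℓ : Level} (R : CommutativeRing c ℓ) where
  open import Data.Nat.Properties using (m≤n⇒m≤1+n; ≤-refl; m≤n+m; m∸n+n≡m)
  open CommutativeRing R renaming (_*_ to _·_)
  open import Algebra.Properties.CommutativeSemigroup +-commutativeSemigroup using (interchange)
  open import Relation.Binary.Reasoning.Setoid setoid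

  Σ : ℕ → (ℕ → Carrier) → Carrier
  Σ = sumTo R

  Σ-cong : ∀ n {f g} → (∀ {k} → k ≤ n → f k ≈ g k) → Σ n f ≈ Σ n g
  Σ-cong zero    f≈g = f≈g z≤n
  Σ-cong (suc n) f≈g = +-cong (Σ-cong n (λ k≤n → f≈g (m≤n⇒m≤1+n k≤n))) (f≈g ≤-refl)

  Σ-cong′ : ∀ n {f g} → (∀ k → f k ≈ g k) → Σ n f ≈ Σ n g
  Σ-cong′ n f≈g = Σ-cong n (λ {k} _ → f≈g k)

  Σ-zero : ∀ n {f} → (∀ k → f k ≈ 0#) → Σ n f ≈ 0#
  Σ-zero zero    f≈0 = f≈0 0
  Σ-zero (suc n) f≈0 = trans (+-cong (Σ-zero n f≈0) (f≈0 (suc n))) (+-identityʳ 0#)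

  Σ-+ : ∀ n f g → Σ n (λ k → f k + g k) ≈ Σ n f + Σ n g
  Σ-+ zero    f g = refl
  Σ-+ (suc n) f g = trans (+-congʳ (Σ-+ n f g)) (interchange _ _ _ _)

  Σ-*ˡ : ∀ n a f → Σ n (λ k → a · f k) ≈ a · Σ n f
  Σ-*ˡ zero    a f = refl
  Σ-*ˡ (suc n) a f = trans (+-congʳ (Σ-*ˡ n a f)) (sym (distribˡ a (Σ n f) (f (suc n))))

  Σ-*ʳ : ∀ n a f → Σ n (λ k → f k · a) ≈ Σ n f · a
  Σ-*ʳ n a f = trans (Σ-cong′ n (λ k → *-comm (f k) a)) (trans (Σ-*ˡ n a f) (*-comm a (Σ n f)))

  Σ-suc : ∀ n f → Σ (suc n) f ≈ f 0 + Σ n (f ∘ suc)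
  Σ-suc zero    f = refl
  Σ-suc (suc n) f = trans (+-congʳ (Σ-suc n f)) (+-assoc _ _ _)

  Σ-extend : ∀ d n {f} → (∀ {k} → n < k → f k ≈ 0#) → Σ (d Nat.+ n) f ≈ Σ n f
  Σ-extend zero    n f≈0 = refl
  Σ-extend (suc d) n f≈0 = trans (+-cong (Σ-extend d n f≈0) (f≈0 (s≤s (m≤n+m n d)))) (+-identityʳ _)

  Σ-extend-≤ : ∀ {n m f} → n ≤ m → (∀ {k} → n < k → f k ≈ 0#) → Σ m f ≈ Σ n f
  Σ-extend-≤ {n} {m} {f} n≤m f≈0 =
    ≡.subst (λ m → Σ m f ≈ Σ n f) (m∸n+n≡m n≤m) (Σ-extend (m ∸ n) n f≈0)

  Σ-dropInitial : ∀ p m {f} → (∀ {k} → k < p → f k ≈ 0#) → Σ (p Nat.+ m) f ≈ Σ m (λ j → f (p Nat.+ j))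
  Σ-dropInitial zero    m f≈0 = refl
  Σ-dropInitial (suc p) m {f} f≈0 = begin
    Σ (suc (p Nat.+ m)) f                 ≈⟨ Σ-suc (p Nat.+ m) f ⟩
    f 0 + Σ (p Nat.+ m) (f ∘ suc)         ≈⟨ +-cong (f≈0 (s≤s z≤n)) (Σ-dropInitial p m (λ k<p → f≈0 (s≤s k<p))) ⟩
    0# + Σ m (λ j → f (suc p Nat.+ j))    ≈⟨ +-identityˡ _ ⟩
    Σ m (λ j → f (suc p Nat.+ j))         ∎

  Σ-comm : ∀ n m (g : ℕ → ℕ → Carrier) → Σ n (λ i → Σ m (g i)) ≈ Σ m (λ j → Σ n (λ i → g i j))
  Σ-comm zero    m g = refl
  Σ-comm (suc n) m g = trans (+-congʳ (Σ-comm n m g)) (sym (Σ-+ m (λ j → Σ n (λ i → g i j)) (g (suc n))))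

module BinomialConvolution {c ℓ : Level} (R : CommutativeRing c ℓ) where
  open import Data.Nat.Properties using (n≤1+n; +-∸-assoc)
  open CommutativeRing R renaming (_*_ to _·_)
  open import Algebra.Properties.CommutativeSemigroup +-commutativeSemigroup using (x∙yz≈y∙xz)
  open import Algebra.Solver.Ring.NaturalCoefficients.Default commutativeSemiring
  open import Relation.Binary.Reasoning.Setoid setoid
  open Embedding R
  open Sums R

  -- The coefficients of the product of the exponential generating functions of f and g;
  -- ⋆-suc is the product rule for derivatives.
  infixl 7 _⋆_
  _⋆_ : (ℕ → Carrier) → (ℕ → Carrier) → ℕ → Carrier
  (f ⋆ g) n = Σ n (λ k → ι R (n C k) · f k · g (n ∸ k))

  ⋆-suc : ∀ f g n → (f ⋆ g) (suc n) ≈ (f ∘ suc ⋆ g) n + (f ⋆ g ∘ suc) n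
  ⋆-suc f g n = begin
    (f ⋆ g) (suc n)                   ≈⟨ Σ-suc n term ⟩
    term 0 + Σ n (term ∘ suc)         ≈⟨ +-congˡ (trans (Σ-cong′ n pascal) (Σ-+ n _ _)) ⟩
    term 0 + ((f ∘ suc ⋆ g) n + Σ n upper)
                                      ≈⟨ x∙yz≈y∙xz _ _ _ ⟩
    (f ∘ suc ⋆ g) n + (term 0 + Σ n upper)
                                      ≈⟨ +-congˡ (trans shift (Σ-suc n term′)) ⟨
    (f ∘ suc ⋆ g) n + (f ⋆ g ∘ suc) n ∎
    where
    term term′ upper : ℕ → Carrier
    term  k = ι R (suc n C k) · f k · g (suc n ∸ k)
    term′ k = ι R (n C k) · f k · g (suc n ∸ k)
    upper k = ι R (n C suc k) · f (suc k) · g (n ∸ k)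
    pascal : ∀ k → term (suc k) ≈ ι R (n C k) · f (suc k) · g (n ∸ k) + upper k
    pascal k = trans (*-congʳ (*-congʳ ι-pascal)) (trans (*-congʳ (distribʳ _ _ _)) (distribʳ _ _ _))
      where
      ι-pascal : ι R (suc n C suc k) ≈ ι R (n C k) + ι R (n C suc k)
      ι-pascal = trans (ι-cong (≡.sym (nCk+nC[k+1]≡[n+1]C[k+1] n k))) (ι-+ (n C k) (n C suc k))
    shift : (f ⋆ g ∘ suc) n ≈ Σ (suc n) term′
    shift = begin
      (f ⋆ g ∘ suc) n ≈⟨ Σ-cong n (λ k≤n → *-congˡ (reflexive (≡.cong g (≡.sym (+-∸-assoc 1 k≤n))))) ⟩
      Σ n term′       ≈⟨ Σ-extend-≤ (n≤1+n n) (λ n<k → trans (*-congʳ (ι-0-·ˡ _ (k>n⇒nCk≡0 n<k))) (zeroˡ _)) ⟨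
      Σ (suc n) term′ ∎

  ⋆-congˡ : ∀ {f f′} g n → (∀ k → f k ≈ f′ k) → (f ⋆ g) n ≈ (f′ ⋆ g) n
  ⋆-congˡ g n f≈f′ = Σ-cong′ n (λ k → *-congʳ (*-congˡ (f≈f′ k)))

  ⋆-congʳ : ∀ f {g g′} n → (∀ k → g k ≈ g′ k) → (f ⋆ g) n ≈ (f ⋆ g′) n
  ⋆-congʳ f n g≈g′ = Σ-cong′ n (λ k → *-congˡ (g≈g′ (n ∸ k)))

  ⋆-zeroˡ : ∀ g n → ((λ _ → 0#) ⋆ g) n ≈ 0#
  ⋆-zeroˡ g n = Σ-zero n (λ k → trans (*-congʳ (zeroʳ _)) (zeroˡ _))

  ⋆-zeroʳ : ∀ f n → (f ⋆ (λ _ → 0#)) n ≈ 0#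
  ⋆-zeroʳ f n = Σ-zero n (λ k → zeroʳ _)

  ⋆-linearˡ : ∀ a f f′ g n → ((λ k → a · f k + f′ k) ⋆ g) n ≈ a · (f ⋆ g) n + (f′ ⋆ g) n
  ⋆-linearˡ a f f′ g n = trans (Σ-cong′ n (λ k → termwise _ _ _ _ _)) (trans (Σ-+ n _ _) (+-congʳ (Σ-*ˡ n a _)))
    where
    termwise : ∀ b a x x′ y → b · (a · x + x′) · y ≈ a · (b · x · y) + b · x′ · y
    termwise = solve 5 (λ b a x x′ y → b :* (a :* x :+ x′) :* y := a :* (b :* x :* y) :+ b :* x′ :* y) refl

  ⋆-linearʳ : ∀ a f g g′ n → (f ⋆ (λ k → a · g k + g′ k)) n ≈ a · (f ⋆ g) n + (f ⋆ g′) n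
  ⋆-linearʳ a f g g′ n = trans (Σ-cong′ n (λ k → termwise _ _ _ _ _)) (trans (Σ-+ n _ _) (+-congʳ (Σ-*ˡ n a _)))
    where
    termwise : ∀ b x a y y′ → b · x · (a · y + y′) ≈ a · (b · x · y) + b · x · y′
    termwise = solve 5 (λ b x a y y′ → b :* x :* (a :* y :+ y′) := a :* (b :* x :* y) :+ b :* x :* y′) refl

module StirlingSeries {c ℓ : Level} (R : CommutativeRing c ℓ) where
  open import Data.Nat.Properties using (m∸n≤m) renaming (*-zeroʳ to n*0≡0)
  open CommutativeRing R renaming (_*_ to _·_)
  open import Algebra.Solver.Ring.NaturalCoefficients.Default commutativeSemiring
  open import Relation.Binary.Reasoning.Setoid setoid
  open StirlingArithmetic
  open Embedding R
  open Sums R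
  open BinomialConvolution R

  column : ℕ → ℕ → Carrier
  column p k = ι R (S k p)

  column-suc : ∀ p k → column p (suc k) ≈ ι R p · column p k + ι R (prev (S k) p)
  column-suc p k = trans (ι-cong (S-suc k p)) (trans (ι-+ (p * S k p) (prev (S k) p)) (+-congʳ (ι-* p (S k p))))

  ⋆-column : ∀ n p j → (column p ⋆ column j) n ≈ ι R (colouredS n p j)
  ⋆-column zero    zero    zero    = trans (*-congʳ (ι-1-·ˡ _)) (ι-1-·ˡ _)
  ⋆-column zero    zero    (suc j) = zeroʳ _
  ⋆-column zero    (suc p) j       = trans (*-congʳ (zeroʳ _)) (zeroˡ _)
  ⋆-column (suc n) p j = begin
    (column p ⋆ column j) (suc n)
      ≈⟨ ⋆-suc (column p) (column j) n ⟩
    (column p ∘ suc ⋆ column j) n + (column p ⋆ column j ∘ suc) n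
      ≈⟨ +-cong (⋆-congˡ (column j) n (column-suc p)) (⋆-congʳ (column p) n (column-suc j)) ⟩
    ((λ k → ι R p · column p k + lower p k) ⋆ column j) n
      + (column p ⋆ (λ k → ι R j · column j k + lower j k)) n
      ≈⟨ +-cong (⋆-linearˡ (ι R p) (column p) (lower p) (column j) n)
                (⋆-linearʳ (ι R j) (column p) (column j) (lower j) n) ⟩
    (ι R p · (column p ⋆ column j) n + (lower p ⋆ column j) n)
      + (ι R j · (column p ⋆ column j) n + (column p ⋆ lower j) n)
      ≈⟨ +-cong (+-cong (*-congˡ (⋆-column n p j)) (lowerˡ p)) (+-cong (*-congˡ (⋆-column n p j)) (lowerʳ j)) ⟩
    (ι R p · ι R (colouredS n p j) + ι R (prev (λ q → colouredS n q j) p))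
      + (ι R j · ι R (colouredS n p j) + ι R (prev (colouredS n p) j))
      ≈⟨ collect _ _ _ _ _ ⟩
    ((ι R p + ι R j) · ι R (colouredS n p j) + ι R (prev (λ q → colouredS n q j) p))
      + ι R (prev (colouredS n p) j)
      ≈⟨ ι-homomorphic p j (colouredS n p j) _ _ ⟨
    ι R ((p Nat.+ j) * colouredS n p j Nat.+ prev (λ q → colouredS n q j) p Nat.+ prev (colouredS n p) j)
      ≈⟨ ι-cong (colouredS-suc n p j) ⟨
    ι R (colouredS (suc n) p j) ∎
    where
    lower : ℕ → ℕ → Carrier
    lower q k = ι R (prev (S k) q)
    lowerˡ : ∀ q → (lower q ⋆ column j) n ≈ ι R (prev (λ q → colouredS n q j) q)
    lowerˡ zero    = ⋆-zeroˡ (column j) n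
    lowerˡ (suc q) = ⋆-column n q j
    lowerʳ : ∀ q → (column p ⋆ lower q) n ≈ ι R (prev (colouredS n p) q)
    lowerʳ zero    = ⋆-zeroʳ (column p) n
    lowerʳ (suc q) = ⋆-column n p q
    collect : ∀ a b x y z → (a · x + y) + (b · x + z) ≈ ((a + b) · x + y) + z
    collect = solve 5 (λ a b x y z → (a :* x :+ y) :+ (b :* x :+ z) := ((a :+ b) :* x :+ y) :+ z) refl
    ι-homomorphic : ∀ a b x y z → ι R ((a Nat.+ b) * x Nat.+ y Nat.+ z) ≈ ((ι R a + ι R b) · ι R x + ι R y) + ι R z
    ι-homomorphic a b x y z =
      trans (ι-+ ((a Nat.+ b) * x Nat.+ y) z)
            (+-congʳ (trans (ι-+ ((a Nat.+ b) * x) y) (+-congʳ (trans (ι-* (a Nat.+ b) x) (*-congʳ (ι-+ a b))))))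

  ⋆-φ : ∀ n f μ → (f ⋆ (λ m → φ R m μ)) n ≈ Σ n (λ j → (f ⋆ column j) n · pow R μ j)
  ⋆-φ n f μ = begin
    Σ n (λ k → coefficient k · φ R (n ∸ k) μ)          ≈⟨ Σ-cong′ n (λ k → *-congˡ (φ-extend k)) ⟩
    Σ n (λ k → coefficient k · Σ n (term k))            ≈⟨ Σ-cong′ n (λ k → Σ-*ˡ n (coefficient k) (term k)) ⟨
    Σ n (λ k → Σ n (λ j → coefficient k · term k j))    ≈⟨ Σ-comm n n _ ⟩
    Σ n (λ j → Σ n (λ k → coefficient k · term k j))    ≈⟨ Σ-cong′ n (λ j → trans (Σ-cong′ n (λ k → sym (*-assoc _ _ _))) (Σ-*ʳ n _ _)) ⟩
    Σ n (λ j → (f ⋆ column j) n · pow R μ j)           ∎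
    where
    coefficient : ℕ → Carrier
    coefficient k = ι R (n C k) · f k
    term : ℕ → ℕ → Carrier
    term k j = ι R (S (n ∸ k) j) · pow R μ j
    φ-extend : ∀ k → φ R (n ∸ k) μ ≈ Σ n (term k)
    φ-extend k = sym (Σ-extend-≤ (m∸n≤m n k) (λ n∸k<j → ι-0-·ˡ _ (n<k⇒S[n,k]≡0 n∸k<j)))

  Σ-S*C-reindex : ∀ n p μ →
    Σ n (λ k → ι R (S n k * (k C p)) · pow R μ k) ≈ Σ n (λ j → ι R (colouredS n p j) · pow R μ (p Nat.+ j))
  Σ-S*C-reindex n p μ =
    trans (sym (Σ-extend p n (λ {k} n<k → ι-0-·ˡ _ (≡.cong (_* (k C p)) (n<k⇒S[n,k]≡0 n<k)))))
          (Σ-dropInitial p n (λ {k} k<p → ι-0-·ˡ _ (≡.trans (≡.cong (S n k *_) (k>n⇒nCk≡0 k<p)) (n*0≡0 (S n k)))))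

proposition6 : {c ℓ : Level} (R : CommutativeRing c ℓ) (n p : ℕ) → p ≤ n → (μ : CommutativeRing.Carrier R) →
    CommutativeRing._≈_ R
      (sumTo R n (λ k → CommutativeRing._*_ R (ι R (S n k * (k C p))) (pow R μ k)))
      (CommutativeRing._*_ R (pow R μ p)
        (sumTo R n (λ k → CommutativeRing._*_ R (ι R ((n C k) * S k p)) (φ R (n ∸ k) μ))))
proposition6 R n p _ μ = begin
  Σ n (λ k → ι R (S n k * (k C p)) · pow R μ k)
    ≈⟨ Σ-S*C-reindex n p μ ⟩
  Σ n (λ j → ι R (colouredS n p j) · pow R μ (p Nat.+ j))
    ≈⟨ Σ-cong′ n (λ j → trans (*-congˡ (^-homo-* μ p j)) (x∙yz≈y∙xz _ _ _)) ⟩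
  Σ n (λ j → pow R μ p · (ι R (colouredS n p j) · pow R μ j))
    ≈⟨ Σ-*ˡ n (pow R μ p) _ ⟩
  pow R μ p · Σ n (λ j → ι R (colouredS n p j) · pow R μ j)
    ≈⟨ *-congˡ (Σ-cong′ n (λ j → *-congʳ (⋆-column n p j))) ⟨
  pow R μ p · Σ n (λ j → (column p ⋆ column j) n · pow R μ j)
    ≈⟨ *-congˡ (⋆-φ n (column p) μ) ⟨
  pow R μ p · (column p ⋆ (λ m → φ R m μ)) n
    ≈⟨ *-congˡ (Σ-cong′ n (λ k → *-congʳ (ι-* (n C k) (S k p)))) ⟨
  pow R μ p · Σ n (λ k → ι R ((n C k) * S k p) · φ R (n ∸ k) μ) ∎
  where
  open CommutativeRing R renaming (_*_ to _·_)
  open import Algebra.Properties.CommutativeSemigroup *-commutativeSemigroup using (x∙yz≈y∙xz)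
  open import Algebra.Properties.Semiring.Exp semiring using (^-homo-*)
  open import Relation.Binary.Reasoning.Setoid setoid
  open StirlingArithmetic using (colouredS)
  open Embedding R using (ι-*)
  open Sums R using (Σ; Σ-cong′; Σ-*ˡ)
  open BinomialConvolution R using (_⋆_)
  open StirlingSeries R using (column; ⋆-column; ⋆-φ; Σ-S*C-reindex)
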